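{- Let $G$ be a $K_3$-saturated graph with $n$ vertices and minimum degree $\delta(G)=\delta$. (a) If $\delta=1$, then $G$ is the star $K_{1,n-1}$. (b) If $\delta=2$, then $G$ is isomorphic to a graph $J$ of the following form: $V(J)=\{y,z\}\cup A\cup B\cup C$ with $y,z$ distinct and $\{y\},\{z\},A,B,C$ pairwise disjoint, $A\neq\emptyset$, and either $B=C=\emptyset$ or both $B\ne\emptyset$ and $C\ne\emptyset$; $A$, $B$, $C$ are independent sets; no vertex of $A$ is adjacent to a vertex of $B\cup C$; every vertex of $B$ is adjacent to every vertex of $C$; $N_J(y)=A\cup B$ and $N_J(z)=A\cup C$ (so $yz\notin E(J)$); and $|A|+|B|+|C|=n-2$. In particular, $J=K_{2,n-2}$ when $B=C=\emptyset$. (c) If $\delta\ge 3$, then \[ 2e(G)\ge \max\{(\delta+1)n-\delta^2-1,\ (\delta+2)n-\delta(\delta+t)-2\}, \] where $t:=\min\{d(v): v \text{ is adjacent to a vertex of degree } \delta \text{ in } G\}$.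
   Context: All graphs are finite and simple. A graph $G$ is $K_3$-saturated if $G$ contains no triangle but for every pair of non-adjacent vertices $u,v$, the graph $G+uv$ contains a triangle. $e(G)$ is the number of edges, $d(v)$ the degree of $v$, and $N_J(v)$ the neighborhood of $v$ in $J$. -}

module Defs where

open import Data.Nat using (ℕ; zero; suc; _+_; _*_; _∸_; _≤_; _<ᵇ_)
open import Data.Bool using (Bool; true; false; if_then_else_; _∧_; _∨_)
open import Data.Fin using (Fin; toℕ)
open import Data.Fin.Properties using (_≟_)
open import Data.List using (List; map; allFin)
open import Data.Nat.ListAction using (sum)
open import Data.Product using (Σ; _×_; _,_; ∃)
open import Data.Sum using (_⊎_)
open import Relation.Nullary using (¬_; does)
open import Relation.Binary.PropositionalEquality using (_≡_; _≢_)
open import Function.Bundles using (_↔_; Inverse)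

record Graph (n : ℕ) : Set where
  field
    adj    : Fin n → Fin n → Bool
    sym    : ∀ u v → adj u v ≡ adj v u
    irrefl : ∀ v → adj v v ≡ false
open Graph public

count : ∀ {n} → (Fin n → Bool) → ℕ
count {n} p = sum (map (λ i → if p i then 1 else 0) (allFin n))

deg : ∀ {n} → Graph n → Fin n → ℕ
deg G v = count (adj G v)

edges : ∀ {n} → Graph n → ℕ
edges {n} G = sum (map (λ i → count (λ j → (toℕ i <ᵇ toℕ j) ∧ adj G i j)) (allFin n))

MinDegree : ∀ {n} → Graph n → ℕ → Set
MinDegree G δ = (∃ λ v → deg G v ≡ δ) × (∀ v → δ ≤ deg G v)

addEdge : ∀ {n} → (Fin n → Fin n → Bool) → Fin n → Fin n → Fin n → Fin n → Bool
addEdge a u v x y =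
  a x y ∨ ((does (x ≟ u) ∧ does (y ≟ v)) ∨ (does (x ≟ v) ∧ does (y ≟ u)))

HasTriangle : ∀ {n} → (Fin n → Fin n → Bool) → Set
HasTriangle {n} a = Σ (Fin n) λ x → Σ (Fin n) λ y → Σ (Fin n) λ z →
  (a x y ≡ true) × (a y z ≡ true) × (a x z ≡ true)

K3Saturated : ∀ {n} → Graph n → Set
K3Saturated G =
  (¬ HasTriangle (adj G)) ×
  (∀ u v → u ≢ v → adj G u v ≡ false → HasTriangle (addEdge (adj G) u v))

IsoTo : ∀ {n} → Graph n → (W : Set) → (W → W → Bool) → Set
IsoTo {n} G W R = Σ (Fin n ↔ W) λ f →
  ∀ u v → adj G u v ≡ R (Inverse.to f u) (Inverse.to f v)

data StarV (m : ℕ) : Set where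
  center : StarV m
  leaf   : Fin m → StarV m

starAdj : ∀ {m} → StarV m → StarV m → Bool
starAdj center   center   = false
starAdj center   (leaf _) = true
starAdj (leaf _) center   = true
starAdj (leaf _) (leaf _) = false

data JV (a b c : ℕ) : Set where
  y z : JV a b c
  inA : Fin a → JV a b c
  inB : Fin b → JV a b c
  inC : Fin c → JV a b c

JAdj : ∀ {a b c} → JV a b c → JV a b c → Bool
JAdj y       (inA _) = true
JAdj y       (inB _) = true
JAdj z       (inA _) = true
JAdj z       (inC _) = true
JAdj (inA _) y       = true
JAdj (inB _) y       = true
JAdj (inA _) z       = true
JAdj (inC _) z       = true
JAdj (inB _) (inC _) = true
JAdj (inC _) (inB _) = true
JAdj _       _       = false

module Submission where

-- Saturation says that every two non-adjacent vertices have a common neighbour,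
-- triangle-freeness that the neighbourhood of a vertex is independent.
-- If d(v) = 1, the neighbour of v is the common neighbour of v with every other
-- vertex, so G is a star. If d(v) = 2 with N(v) = {y, z}, every vertex other than
-- y and z is adjacent to y or z, and sorting the vertices by their adjacency to y
-- and z gives J; B and C are completely joined, since a common neighbour of b ∈ B
-- and c ∈ C would close a triangle, and a vertex of B has a second neighbour,
-- which lies in C. Both isomorphisms are built by assigning each vertex a role such
-- that adjacency depends only on the roles, and matching fibres of equal sizes.
-- For (c) the degree sum is counted relative to a vertex set P: every vertex
-- outside P contributes its degree and its neighbours in P. For P = N[v] each
-- outside vertex has a neighbour in N(v); for P = N(u) ∪ N(v) with uv an edge it
-- has one in N(u) and one in N(v), distinct because N(u) ∩ N(v) = ∅.

open import Defs renaming (sym to adj-sym)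
open import Data.Nat using (ℕ; zero; suc; _+_; _*_; _∸_; _≤_; _≥_; _<ᵇ_; z≤n; s≤s)
open import Data.Nat.Properties hiding (_≟_)
open import Data.Bool using (Bool; true; false; if_then_else_; _∧_; _∨_; not)
open import Data.Bool.Properties using (∧-identityʳ; ∧-zeroʳ; ∧-comm; ∨-comm; ∨-identityʳ; ∨-zeroʳ)
open import Data.Nat.Tactic.RingSolver using (solve-∀)
open import Data.Fin using (Fin; zero; suc; toℕ)
open import Data.Fin.Properties using (_≟_; toℕ-injective; +↔⊎)
open import Data.List using (map; allFin; tabulate)
open import Data.List.Properties using (map-tabulate)
open import Data.Nat.ListAction renaming (sum to sumᴸ)
open import Data.Product using (Σ; _×_; ∃; ∃₂; _,_; proj₁; proj₂)
open import Data.Sum using (_⊎_; inj₁; inj₂; [_,_]′; swap)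
open import Data.Empty using (⊥; ⊥-elim)
open import Function using (_∘_; id)
open import Function.Bundles using (_↔_; Inverse; mk↔ₛ′)
open import Function.Properties.Inverse using (↔-refl; ↔-sym; ↔-trans)
open import Data.Sum.Function.Propositional using (_⊎-↔_)
open import Axiom.UniquenessOfIdentityProofs using (module Decidable⇒UIP)
open import Relation.Nullary using (¬_; Dec; does; yes; no; ofʸ; ofⁿ)
open import Relation.Binary.PropositionalEquality
open import Algebra.Properties.Semiring.Sum +-*-semiring
  using (sum-syntax; sum-cong-≗; sum-replicate-zero; ∑-distrib-+; ∑-comm; *-distribˡ-sum; *-distribʳ-sum)
  renaming (sum to ∑)

⟦_⟧ : Bool → ℕ
⟦ b ⟧ = if b then 1 else 0

_≡ᵇ_ : ∀ {n} → Fin n → Fin n → Bool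
i ≡ᵇ j = does (i ≟ j)

≡ᵇ-refl : ∀ {n} (i : Fin n) → (i ≡ᵇ i) ≡ true
≡ᵇ-refl i with i ≟ i
... | yes _ = refl
... | no i≢i = ⊥-elim (i≢i refl)

≢⇒≡ᵇ-false : ∀ {n} {i j : Fin n} → i ≢ j → (i ≡ᵇ j) ≡ false
≢⇒≡ᵇ-false {i = i} {j} i≢j with i ≟ j
... | yes i≡j = ⊥-elim (i≢j i≡j)
... | no _ = refl

true-or-false : ∀ b → b ≡ true ⊎ b ≡ false
true-or-false true  = inj₁ refl
true-or-false false = inj₂ refl

not-both : ∀ {b} → b ≡ true → b ≡ false → ⊥
not-both refl ()

∧-true : ∀ {a b} → a ∧ b ≡ true → a ≡ true × b ≡ true
∧-true {true} {true} _ = refl , refl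

∨-true : ∀ {a b} → a ∨ b ≡ true → a ≡ true ⊎ b ≡ true
∨-true {true}  _  = inj₁ refl
∨-true {false} ab = inj₂ ab

does-true : ∀ {A : Set} (a? : Dec A) → does a? ≡ true → A
does-true (yes a) _ = a

≡ᵇ-sym : ∀ {n} (i j : Fin n) → (i ≡ᵇ j) ≡ (j ≡ᵇ i)
≡ᵇ-sym i j with i ≟ j | j ≟ i
... | yes _   | yes _   = refl
... | no _    | no _    = refl
... | yes i≡j | no j≢i  = ⊥-elim (j≢i (sym i≡j))
... | no i≢j  | yes j≡i = ⊥-elim (i≢j (sym j≡i))

_∖_ : ∀ {n} → (Fin n → Bool) → Fin n → Fin n → Bool
(p ∖ x) i = p i ∧ not (i ≡ᵇ x)

+-comm-last : ∀ a b c → a + b + c ≡ a + c + b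
+-comm-last a b c = trans (+-assoc a b c) (trans (cong (a +_) (+-comm b c)) (sym (+-assoc a c b)))

∑-cong : ∀ {n} {f g : Fin n → ℕ} → (∀ i → f i ≡ g i) → ∑ f ≡ ∑ g
∑-cong {f = f} {g} = sum-cong-≗ {x = f} {g}

∑-mono-≤ : ∀ {n} {f g : Fin n → ℕ} → (∀ i → f i ≤ g i) → ∑ f ≤ ∑ g
∑-mono-≤ {zero}  _   = z≤n
∑-mono-≤ {suc n} f≤g = +-mono-≤ (f≤g zero) (∑-mono-≤ (f≤g ∘ suc))

∑-at : ∀ {n} (x : Fin n) c → ∑[ i < n ] (if i ≡ᵇ x then c else 0) ≡ c
∑-at {suc n} zero    c = trans (cong (c +_) (sum-replicate-zero n)) (+-identityʳ c)
∑-at {suc n} (suc x) c = ∑-at x c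

∑-point : ∀ {n} (x : Fin n) → ∑[ i < n ] ⟦ i ≡ᵇ x ⟧ ≡ 1
∑-point x = ∑-at x 1

∑-one : ∀ n → ∑[ i < n ] 1 ≡ n
∑-one zero    = refl
∑-one (suc n) = cong suc (∑-one n)

sumᴸ-allFin : ∀ {n} (f : Fin n → ℕ) → sumᴸ (map f (allFin n)) ≡ ∑ f
sumᴸ-allFin f = trans (cong sumᴸ (map-tabulate id f)) (sumᴸ-tabulate f)
  where
  sumᴸ-tabulate : ∀ {m} (f : Fin m → ℕ) → sumᴸ (tabulate f) ≡ ∑ f
  sumᴸ-tabulate {zero}  f = refl
  sumᴸ-tabulate {suc m} f = cong (f zero +_) (sumᴸ-tabulate (f ∘ suc))

count≡∑ : ∀ {n} (p : Fin n → Bool) → count p ≡ ∑[ i < n ] ⟦ p i ⟧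
count≡∑ p = sumᴸ-allFin (⟦_⟧ ∘ p)

∑-indicator-* : ∀ {n} (p : Fin n → Bool) c → ∑[ i < n ] (⟦ p i ⟧ * c) ≡ count p * c
∑-indicator-* p c = trans (sym (*-distribʳ-sum c (⟦_⟧ ∘ p))) (cong (_* c) (sym (count≡∑ p)))

count-point : ∀ {n} (x : Fin n) → count (_≡ᵇ x) ≡ 1
count-point x = trans (count≡∑ (_≡ᵇ x)) (∑-point x)

count-cong : ∀ {n} {p q : Fin n → Bool} → (∀ i → p i ≡ q i) → count p ≡ count q
count-cong {p = p} {q} p≗q = begin
  count p         ≡⟨ count≡∑ p ⟩
  ∑ (⟦_⟧ ∘ p)     ≡⟨ ∑-cong (cong ⟦_⟧ ∘ p≗q) ⟩
  ∑ (⟦_⟧ ∘ q)     ≡⟨ count≡∑ q ⟨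
  count q         ∎
  where open ≡-Reasoning

count-mono : ∀ {n} (p q : Fin n → Bool) → (∀ i → p i ≡ true → q i ≡ true) → count p ≤ count q
count-mono p q p⊆q = begin
  count p         ≡⟨ count≡∑ p ⟩
  ∑ (⟦_⟧ ∘ p)     ≤⟨ ∑-mono-≤ (λ i → ⟦⟧-mono (p⊆q i)) ⟩
  ∑ (⟦_⟧ ∘ q)     ≡⟨ count≡∑ q ⟨
  count q         ∎
  where
  open ≤-Reasoning
  ⟦⟧-mono : ∀ {b c} → (b ≡ true → c ≡ true) → ⟦ b ⟧ ≤ ⟦ c ⟧
  ⟦⟧-mono {false}         _   = z≤n
  ⟦⟧-mono {true}  {true}  _   = ≤-refl
  ⟦⟧-mono {true}  {false} b⇒c with () ← b⇒c refl

count-none : ∀ {n} {p : Fin n → Bool} → (∀ i → p i ≡ false) → count p ≡ 0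
count-none {n} p≗false = trans (count-cong p≗false) (trans (count≡∑ {n} (λ _ → false)) (sum-replicate-zero n))

count-complement : ∀ {n} (p : Fin n → Bool) → count p + count (not ∘ p) ≡ n
count-complement {n} p = begin
  count p + count (not ∘ p)             ≡⟨ cong₂ _+_ (count≡∑ p) (count≡∑ (not ∘ p)) ⟩
  ∑ (⟦_⟧ ∘ p) + ∑ (⟦_⟧ ∘ not ∘ p)       ≡⟨ ∑-distrib-+ (⟦_⟧ ∘ p) (⟦_⟧ ∘ not ∘ p) ⟨
  ∑[ i < n ] (⟦ p i ⟧ + ⟦ not (p i) ⟧)  ≡⟨ ∑-cong (λ i → ⟦b⟧+⟦not-b⟧ (p i)) ⟩
  ∑[ i < n ] 1                          ≡⟨ ∑-one n ⟩
  n                                     ∎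
  where
  open ≡-Reasoning
  ⟦b⟧+⟦not-b⟧ : ∀ b → ⟦ b ⟧ + ⟦ not b ⟧ ≡ 1
  ⟦b⟧+⟦not-b⟧ true  = refl
  ⟦b⟧+⟦not-b⟧ false = refl

count-∨ : ∀ {n} (p q : Fin n → Bool) → (∀ i → p i ≡ true → q i ≡ false) →
          count (λ i → p i ∨ q i) ≡ count p + count q
count-∨ {n} p q disjoint = begin
  count (λ i → p i ∨ q i)        ≡⟨ count≡∑ (λ i → p i ∨ q i) ⟩
  ∑[ i < n ] ⟦ p i ∨ q i ⟧       ≡⟨ ∑-cong (λ i → ⟦∨⟧ (p i) (q i) (disjoint i)) ⟩
  ∑[ i < n ] (⟦ p i ⟧ + ⟦ q i ⟧) ≡⟨ ∑-distrib-+ (⟦_⟧ ∘ p) (⟦_⟧ ∘ q) ⟩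
  ∑ (⟦_⟧ ∘ p) + ∑ (⟦_⟧ ∘ q)      ≡⟨ cong₂ _+_ (count≡∑ p) (count≡∑ q) ⟨
  count p + count q              ∎
  where
  open ≡-Reasoning
  ⟦∨⟧ : ∀ b c → (b ≡ true → c ≡ false) → ⟦ b ∨ c ⟧ ≡ ⟦ b ⟧ + ⟦ c ⟧
  ⟦∨⟧ true  c b⇒¬c rewrite b⇒¬c refl = refl
  ⟦∨⟧ false c _ = refl

count-remove : ∀ {n} (p : Fin n → Bool) {x} → p x ≡ true → count p ≡ suc (count (p ∖ x))
count-remove {n} p {x} px = begin
  count p                                       ≡⟨ count≡∑ p ⟩
  ∑[ i < n ] ⟦ p i ⟧                            ≡⟨ ∑-cong split ⟩
  ∑[ i < n ] (⟦ i ≡ᵇ x ⟧ + ⟦ (p ∖ x) i ⟧)       ≡⟨ ∑-distrib-+ (λ i → ⟦ i ≡ᵇ x ⟧) (⟦_⟧ ∘ (p ∖ x)) ⟩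
  ∑[ i < n ] ⟦ i ≡ᵇ x ⟧ + ∑ (⟦_⟧ ∘ (p ∖ x))     ≡⟨ cong₂ _+_ (∑-point x) (sym (count≡∑ (p ∖ x))) ⟩
  suc (count (p ∖ x))                           ∎
  where
  open ≡-Reasoning
  split : ∀ i → ⟦ p i ⟧ ≡ ⟦ i ≡ᵇ x ⟧ + ⟦ (p ∖ x) i ⟧
  split i with i ≟ x
  ... | yes refl rewrite px = refl
  ... | no _ = sym (cong ⟦_⟧ (∧-identityʳ (p i)))

∖-intro : ∀ {n} (p : Fin n → Bool) {x j} → p j ≡ true → j ≢ x → (p ∖ x) j ≡ true
∖-intro p pj j≢x = cong₂ _∧_ pj (cong not (≢⇒≡ᵇ-false j≢x))

∖-elim : ∀ {n} {p : Fin n → Bool} {x j} → (p ∖ x) j ≡ true → p j ≡ true × j ≢ x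
∖-elim {p = p} {x} {j} p∖x-j with p j | j ≟ x
∖-elim refl | true | no j≢x = refl , j≢x

count-≥1 : ∀ {n} (p : Fin n → Bool) {x} → p x ≡ true → 1 ≤ count p
count-≥1 p px = subst (1 ≤_) (sym (count-remove p px)) (s≤s z≤n)

count-≥2 : ∀ {n} (p : Fin n → Bool) {x j} → p x ≡ true → p j ≡ true → j ≢ x → 2 ≤ count p
count-≥2 p {x} px pj j≢x = subst (2 ≤_) (sym (count-remove p px)) (s≤s (count-≥1 (p ∖ x) (∖-intro p pj j≢x)))

count-suc : ∀ {n} (p : Fin (suc n) → Bool) → count p ≡ ⟦ p zero ⟧ + count (p ∘ suc)
count-suc p = trans (count≡∑ p) (cong (⟦ p zero ⟧ +_) (sym (count≡∑ (p ∘ suc))))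

count-witness : ∀ {n} (p : Fin n → Bool) → 1 ≤ count p → ∃ λ x → p x ≡ true
count-witness {suc n} p 1≤count = search (subst (1 ≤_) (count-suc p) 1≤count)
  where
  search : 1 ≤ ⟦ p zero ⟧ + count (p ∘ suc) → ∃ λ x → p x ≡ true
  search 1≤count′ with p zero in p0
  ... | true  = zero , p0
  ... | false with x , px ← count-witness (p ∘ suc) 1≤count′ = suc x , px

count-unique : ∀ {n} (p : Fin n → Bool) {x} → p x ≡ true → (∀ j → p j ≡ true → j ≡ x) → count p ≡ 1
count-unique p {x} px unique = trans (count-remove p px) (cong suc (count-none p∖x-empty))
  where
  p∖x-empty : ∀ i → (p ∖ x) i ≡ false
  p∖x-empty i with p i in pi
  ... | false = refl
  ... | true rewrite unique i pi | ≡ᵇ-refl x = refl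

count-pick : ∀ {n} (p : Fin n → Bool) {m} → count p ≡ suc m → ∃ λ x → p x ≡ true × count (p ∖ x) ≡ m
count-pick p count≡ with x , px ← count-witness p (≤-trans (s≤s z≤n) (≤-reflexive (sym count≡))) =
  x , px , suc-injective (trans (sym (count-remove p px)) count≡)

count-≡1 : ∀ {n} (p : Fin n → Bool) → count p ≡ 1 → ∃ λ x → p x ≡ true × (∀ j → p j ≡ true → j ≡ x)
count-≡1 p count≡1 with x , px , count∖≡0 ← count-pick p count≡1 = x , px , unique
  where
  unique : ∀ j → p j ≡ true → j ≡ x
  unique j pj with j ≟ x
  ... | yes j≡x = j≡x
  ... | no j≢x with () ← ≤-trans (count-≥1 (p ∖ x) (∖-intro p pj j≢x)) (≤-reflexive count∖≡0)

count-≡2 : ∀ {n} (p : Fin n → Bool) → count p ≡ 2 →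
           ∃₂ λ x x′ → x′ ≢ x × p x ≡ true × p x′ ≡ true × (∀ j → p j ≡ true → j ≡ x ⊎ j ≡ x′)
count-≡2 p count≡2
  with x , px , count∖≡1 ← count-pick p count≡2
  with x′ , p∖x-x′ , unique ← count-≡1 (p ∖ x) count∖≡1
  with px′ , x′≢x ← ∖-elim {p = p} p∖x-x′ = x , x′ , x′≢x , px , px′ , pair
  where
  pair : ∀ j → p j ≡ true → j ≡ x ⊎ j ≡ x′
  pair j pj with j ≟ x
  ... | yes j≡x = inj₁ j≡x
  ... | no j≢x = inj₂ (unique j (∖-intro p pj j≢x))

-- Degree sums

module _ {n} (G : Graph n) where

  degIn : (Fin n → Bool) → Fin n → ℕ
  degIn P w = count (λ k → adj G w k ∧ P k)

  degIn-≥1 : ∀ P {w k} → adj G w k ≡ true → P k ≡ true → 1 ≤ degIn P w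
  degIn-≥1 P {w} wk Pk = count-≥1 (λ k → adj G w k ∧ P k) (cong₂ _∧_ wk Pk)

  degIn-≥2 : ∀ P {w k k′} → adj G w k ≡ true → P k ≡ true → adj G w k′ ≡ true → P k′ ≡ true → k′ ≢ k → 2 ≤ degIn P w
  degIn-≥2 P {w} wk Pk wk′ Pk′ = count-≥2 (λ k → adj G w k ∧ P k) (cong₂ _∧_ wk Pk) (cong₂ _∧_ wk′ Pk′)

  deg≤degIn : ∀ P {w} → (∀ {k} → adj G w k ≡ true → P k ≡ true) → deg G w ≤ degIn P w
  deg≤degIn P {w} N⊆P = count-mono (adj G w) (λ k → adj G w k ∧ P k) (λ k wk → cong₂ _∧_ wk (N⊆P wk))

  handshake : 2 * edges G ≡ ∑[ v < n ] deg G v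
  handshake = begin
    2 * edges G                                           ≡⟨ cong (2 *_) edges≡E ⟩
    E + (E + 0)                                           ≡⟨ cong (E +_) (+-identityʳ E) ⟩
    E + E                                                 ≡⟨ cong (E +_) (∑-comm later) ⟩
    E + ∑[ i < n ] ∑[ j < n ] later j i                  ≡⟨ ∑-distrib-+ (λ i → ∑ (earlier i)) (λ i → ∑[ j < n ] later j i) ⟨
    ∑[ i < n ] (∑ (earlier i) + ∑[ j < n ] later j i)    ≡⟨ ∑-cong (λ i → ∑-distrib-+ (earlier i) (λ j → later j i)) ⟨
    ∑[ i < n ] ∑[ j < n ] (earlier i j + later j i)      ≡⟨ ∑-cong (λ i → ∑-cong (λ j → ⟦adj⟧-split i j)) ⟨
    ∑[ i < n ] ∑[ j < n ] ⟦ adj G i j ⟧                  ≡⟨ ∑-cong (λ i → count≡∑ (adj G i)) ⟨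
    ∑[ v < n ] deg G v                                    ∎
    where
    open ≡-Reasoning
    _≺_ : Fin n → Fin n → Bool
    i ≺ j = toℕ i <ᵇ toℕ j
    earlier later : Fin n → Fin n → ℕ
    earlier i j = ⟦ i ≺ j ∧ adj G i j ⟧
    later j i = ⟦ j ≺ i ∧ adj G j i ⟧
    E : ℕ
    E = ∑[ i < n ] ∑ (earlier i)
    edges≡E : edges G ≡ E
    edges≡E = trans (sumᴸ-allFin (λ i → count (λ j → i ≺ j ∧ adj G i j))) (∑-cong (λ i → count≡∑ (λ j → i ≺ j ∧ adj G i j)))
    ⟦adj⟧-split : ∀ i j → ⟦ adj G i j ⟧ ≡ earlier i j + later j i
    ⟦adj⟧-split i j
      with toℕ i <ᵇ toℕ j | <ᵇ-reflects-< (toℕ i) (toℕ j) | toℕ j <ᵇ toℕ i | <ᵇ-reflects-< (toℕ j) (toℕ i)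
    ... | true  | ofʸ i<j | true  | ofʸ j<i = ⊥-elim (<-asym i<j j<i)
    ... | true  | _       | false | _       = sym (+-identityʳ _)
    ... | false | _       | true  | _       = cong ⟦_⟧ (adj-sym G i j)
    ... | false | ofⁿ i≮j | false | ofⁿ j≮i
      rewrite toℕ-injective (≤-antisym (≮⇒≥ j≮i) (≮⇒≥ i≮j)) = cong ⟦_⟧ (irrefl G j)

  ∑-degIn : ∀ Q → ∑[ w < n ] degIn Q w ≡ ∑[ k < n ] (⟦ Q k ⟧ * deg G k)
  ∑-degIn Q = begin
    ∑[ w < n ] degIn Q w                            ≡⟨ ∑-cong (λ w → count≡∑ (λ k → adj G w k ∧ Q k)) ⟩
    ∑[ w < n ] ∑[ k < n ] ⟦ adj G w k ∧ Q k ⟧       ≡⟨ ∑-comm (λ w k → ⟦ adj G w k ∧ Q k ⟧) ⟩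
    ∑[ k < n ] ∑[ w < n ] ⟦ adj G w k ∧ Q k ⟧       ≡⟨ ∑-cong (λ k → ∑-cong (λ w → ⟦∧⟧-sym (adj G w k) (Q k) (adj-sym G w k))) ⟩
    ∑[ k < n ] ∑[ w < n ] (⟦ Q k ⟧ * ⟦ adj G k w ⟧) ≡⟨ ∑-cong (λ k → *-distribˡ-sum ⟦ Q k ⟧ (⟦_⟧ ∘ adj G k)) ⟨
    ∑[ k < n ] (⟦ Q k ⟧ * ∑[ w < n ] ⟦ adj G k w ⟧) ≡⟨ ∑-cong (λ k → cong (⟦ Q k ⟧ *_) (count≡∑ (adj G k))) ⟨
    ∑[ k < n ] (⟦ Q k ⟧ * deg G k)                  ∎
    where
    open ≡-Reasoning
    ⟦∧⟧-sym : ∀ a q {a′} → a ≡ a′ → ⟦ a ∧ q ⟧ ≡ ⟦ q ⟧ * ⟦ a′ ⟧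
    ⟦∧⟧-sym true  true  refl = refl
    ⟦∧⟧-sym true  false refl = refl
    ⟦∧⟧-sym false true  refl = refl
    ⟦∧⟧-sym false false refl = refl

  degreeSum-split : ∀ P → 2 * edges G ≡ ∑ (degIn P) + ∑[ w < n ] (⟦ not (P w) ⟧ * deg G w)
  degreeSum-split P = begin
    2 * edges G                                        ≡⟨ handshake ⟩
    ∑[ w < n ] deg G w                                 ≡⟨ ∑-cong deg-split ⟩
    ∑[ w < n ] (degIn P w + degIn (not ∘ P) w)         ≡⟨ ∑-distrib-+ (degIn P) (degIn (not ∘ P)) ⟩
    ∑ (degIn P) + ∑ (degIn (not ∘ P))                  ≡⟨ cong (∑ (degIn P) +_) (∑-degIn (not ∘ P)) ⟩
    ∑ (degIn P) + ∑[ w < n ] (⟦ not (P w) ⟧ * deg G w) ∎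
    where
    open ≡-Reasoning
    deg-split : ∀ w → deg G w ≡ degIn P w + degIn (not ∘ P) w
    deg-split w = trans (count-cong (λ k → split (adj G w k) (P k)))
                        (count-∨ (λ k → adj G w k ∧ P k) (λ k → adj G w k ∧ not (P k)) (λ k → disjoint (adj G w k) (P k)))
      where
      split : ∀ a p → a ≡ (a ∧ p) ∨ (a ∧ not p)
      split true  true  = refl
      split true  false = refl
      split false _     = refl
      disjoint : ∀ a p → a ∧ p ≡ true → a ∧ not p ≡ false
      disjoint true true _ = refl

  -- A vertex outside P contributes its neighbours in P and, once more, its degree.
  degreeSum-lowerBound : ∀ P {δ} (A s : Fin n → ℕ) → (∀ w → δ ≤ deg G w) → (∀ w → A w ≤ degIn P w + s w) →
                         ∑ A + count (not ∘ P) * δ ≤ 2 * edges G + ∑ s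
  degreeSum-lowerBound P {δ} A s δ≤deg A≤ = begin
    ∑ A + count (not ∘ P) * δ                                   ≡⟨ cong (∑ A +_) (∑-indicator-* (not ∘ P) δ) ⟨
    ∑ A + ∑[ w < n ] (⟦ not (P w) ⟧ * δ)                        ≤⟨ +-mono-≤ (∑-mono-≤ A≤) (∑-mono-≤ (λ w → *-monoʳ-≤ ⟦ not (P w) ⟧ (δ≤deg w))) ⟩
    ∑[ w < n ] (degIn P w + s w) + ∑ outside                    ≡⟨ cong (_+ ∑ outside) (∑-distrib-+ (degIn P) s) ⟩
    ∑ (degIn P) + ∑ s + ∑ outside                               ≡⟨ +-comm-last (∑ (degIn P)) (∑ s) (∑ outside) ⟩
    ∑ (degIn P) + ∑ outside + ∑ s                               ≡⟨ cong (_+ ∑ s) (degreeSum-split P) ⟨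
    2 * edges G + ∑ s                                           ∎
    where
    open ≤-Reasoning
    outside : Fin n → ℕ
    outside w = ⟦ not (P w) ⟧ * deg G w

module _ {n} (G : Graph n) where

  sym-adj : ∀ {x k b} → adj G x k ≡ b → adj G k x ≡ b
  sym-adj {x} {k} e = trans (adj-sym G k x) e

  adjacent⇒≢ : ∀ {x k} → adj G x k ≡ true → k ≢ x
  adjacent⇒≢ {x} xk refl = not-both xk (irrefl G x)

  triangleFree⇒nonadjacent : ¬ HasTriangle (adj G) → ∀ {x i j} →
    adj G x i ≡ true → adj G x j ≡ true → adj G i j ≡ false
  triangleFree⇒nonadjacent ∄△ {x} {i} {j} xi xj with adj G i j in ij
  ... | true  = ⊥-elim (∄△ (x , i , j , xi , ij , xj))
  ... | false = refl

  module _ {u v : Fin n} (u≢v : u ≢ v) where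

    private
      G+uv = addEdge (adj G) u v

    addEdge-irrefl : ∀ x → G+uv x x ≡ false
    addEdge-irrefl x with x ≟ u | x ≟ v
    ... | yes refl | yes refl = ⊥-elim (u≢v refl)
    ... | yes refl | no _     = trans (∨-identityʳ (adj G x x)) (irrefl G x)
    ... | no _     | yes refl = trans (∨-identityʳ (adj G x x)) (irrefl G x)
    ... | no _     | no _     = trans (∨-identityʳ (adj G x x)) (irrefl G x)

    addEdge-sym : ∀ x k → G+uv x k ≡ G+uv k x
    addEdge-sym x k = cong₂ _∨_ (adj-sym G x k)
      (trans (∨-comm (does (x ≟ u) ∧ does (k ≟ v)) _)
             (cong₂ _∨_ (∧-comm (does (x ≟ v)) _) (∧-comm (does (x ≟ u)) _)))

    addEdge-away : ∀ x {k} → k ≢ u → k ≢ v → G+uv x k ≡ adj G x k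
    addEdge-away x {k} k≢u k≢v
      rewrite ≢⇒≡ᵇ-false k≢u | ≢⇒≡ᵇ-false k≢v
            | ∧-zeroʳ (does (x ≟ u)) | ∧-zeroʳ (does (x ≟ v)) = ∨-identityʳ (adj G x k)

    addEdge-new : ∀ {x k} → G+uv x k ≡ true → adj G x k ≡ false → (x ≡ u × k ≡ v) ⊎ (x ≡ v × k ≡ u)
    addEdge-new {x} {k} e old with ∨-true e
    ... | inj₁ xk = ⊥-elim (not-both xk old)
    ... | inj₂ new with ∨-true new
    ... | inj₁ xu∧kv with xu , kv ← ∧-true xu∧kv = inj₁ (does-true (x ≟ u) xu , does-true (k ≟ v) kv)
    ... | inj₂ xv∧ku with xv , ku ← ∧-true xv∧ku = inj₂ (does-true (x ≟ v) xv , does-true (k ≟ u) ku)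

    addEdge-common : ∀ {r} → G+uv u r ≡ true → G+uv v r ≡ true → ∃ λ w → adj G u w ≡ true × adj G v w ≡ true
    addEdge-common {r} ur vr = r , old ur , old vr
      where
      r≢u : r ≢ u
      r≢u refl = not-both ur (addEdge-irrefl r)
      r≢v : r ≢ v
      r≢v refl = not-both vr (addEdge-irrefl r)
      old : ∀ {x} → G+uv x r ≡ true → adj G x r ≡ true
      old {x} xr = trans (sym (addEdge-away x r≢u r≢v)) xr

    addEdge-apex : ∀ {x x′ k} → G+uv x x′ ≡ true → adj G x x′ ≡ false → G+uv x k ≡ true → G+uv x′ k ≡ true →
                   ∃ λ w → adj G u w ≡ true × adj G v w ≡ true
    addEdge-apex e old xk x′k with addEdge-new e old
    ... | inj₁ (refl , refl) = addEdge-common xk x′k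
    ... | inj₂ (refl , refl) = addEdge-common x′k xk

    addEdge-triangle⇒common : ¬ HasTriangle (adj G) → HasTriangle G+uv →
                              ∃ λ w → adj G u w ≡ true × adj G v w ≡ true
    addEdge-triangle⇒common ∄△ (p , q , r , pq , qr , pr)
      with true-or-false (adj G p q) | true-or-false (adj G q r) | true-or-false (adj G p r)
    ... | inj₂ pq-old | _           | _           = addEdge-apex pq pq-old pr qr
    ... | inj₁ _      | inj₂ qr-old | _           = addEdge-apex qr qr-old (trans (addEdge-sym q p) pq) (trans (addEdge-sym r p) pr)
    ... | inj₁ _      | inj₁ _      | inj₂ pr-old = addEdge-apex pr pr-old pq (trans (addEdge-sym r q) qr)
    ... | inj₁ pq-old | inj₁ qr-old | inj₁ pr-old = ⊥-elim (∄△ (p , q , r , pq-old , qr-old , pr-old))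

-- Graphs whose adjacency is determined by vertex roles

fibres↔ : ∀ {A B : Set} (f : A → B) → A ↔ Σ B (λ b → Σ A (λ a → f a ≡ b))
fibres↔ f = mk↔ₛ′ (λ a → f a , a , refl) (λ (_ , a , _) → a) (λ { (_ , _ , refl) → refl }) (λ _ → refl)

Σ-fibrewise↔ : ∀ {B : Set} {C D : B → Set} → (∀ b → C b ↔ D b) → Σ B C ↔ Σ B D
Σ-fibrewise↔ e = mk↔ₛ′
  (λ (b , c) → b , Inverse.to (e b) c) (λ (b , d) → b , Inverse.from (e b) d)
  (λ (b , d) → cong (b ,_) (Inverse.strictlyInverseˡ (e b) d))
  (λ (b , c) → cong (b ,_) (Inverse.strictlyInverseʳ (e b) c))

Fin-cong↔ : ∀ {m m′} → m ≡ m′ → Fin m ↔ Fin m′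
Fin-cong↔ refl = ↔-refl

Dec↔Fin : ∀ {A : Set} (a? : Dec A) → (∀ (a b : A) → a ≡ b) → A ↔ Fin ⟦ does a? ⟧
Dec↔Fin (yes a) irr = mk↔ₛ′ (λ _ → zero) (λ _ → a) (λ { zero → refl }) (irr a)
Dec↔Fin (no ¬a) _   = mk↔ₛ′ (λ a → ⊥-elim (¬a a)) (λ ()) (λ ()) (λ a → ⊥-elim (¬a a))

Σ-Fin-suc↔ : ∀ {n} {P : Fin (suc n) → Set} → Σ (Fin (suc n)) P ↔ (P zero ⊎ Σ (Fin n) (P ∘ suc))
Σ-Fin-suc↔ = mk↔ₛ′
  (λ { (zero , p) → inj₁ p ; (suc x , p) → inj₂ (x , p) })
  (λ { (inj₁ p) → zero , p ; (inj₂ (x , p)) → suc x , p })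
  (λ { (inj₁ _) → refl ; (inj₂ _) → refl })
  (λ { (zero , _) → refl ; (suc _ , _) → refl })

Σ-Fin↔count : ∀ {n} {P : Fin n → Set} (P? : ∀ x → Dec (P x)) → (∀ {x} (p q : P x) → p ≡ q) →
              Σ (Fin n) P ↔ Fin (count (does ∘ P?))
Σ-Fin↔count {zero}          P? irr = mk↔ₛ′ (λ ()) (λ ()) (λ ()) (λ ())
Σ-Fin↔count {suc n} {P = P} P? irr =
  subst (λ m → Σ (Fin (suc n)) P ↔ Fin m) (sym (count-suc (does ∘ P?)))
    (↔-trans Σ-Fin-suc↔ (↔-trans (Dec↔Fin (P? zero) irr ⊎-↔ Σ-Fin↔count (P? ∘ suc) irr) (↔-sym +↔⊎)))

fibreSize : ∀ {n k} → (Fin n → Fin k) → Fin k → ℕ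
fibreSize ρ r = count (λ x → ρ x ≡ᵇ r)

-- By construction the first component of the image of x is ρ x, which
-- IsoTo-byRoles relies on.
Fin↔Σfibres : ∀ {n k} (ρ : Fin n → Fin k) → Fin n ↔ Σ (Fin k) (Fin ∘ fibreSize ρ)
Fin↔Σfibres ρ = ↔-trans (fibres↔ ρ) (Σ-fibrewise↔ (λ r → Σ-Fin↔count (λ x → ρ x ≟ r) (Decidable⇒UIP.≡-irrelevant _≟_)))

IsoTo-byRoles : ∀ {n k} (G : Graph n) (ρ : Fin n → Fin k) (R : Fin k → Fin k → Bool)
  {W : Set} {WAdj : W → W → Bool} (s : Fin k → ℕ) →
  (∀ i j → adj G i j ≡ R (ρ i) (ρ j)) → (∀ r → fibreSize ρ r ≡ s r) →
  (e : Σ (Fin k) (Fin ∘ s) ↔ W) → (∀ p q → WAdj (Inverse.to e p) (Inverse.to e q) ≡ R (proj₁ p) (proj₁ q)) →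
  IsoTo G W WAdj
IsoTo-byRoles G ρ R s adj≡R sizes e e-adj = ↔-trans g e , λ i j → trans (adj≡R i j) (sym (e-adj (to g i) (to g j)))
  where
  open Inverse using (to)
  g : Fin _ ↔ Σ (Fin _) (Fin ∘ s)
  g = ↔-trans (Fin↔Σfibres ρ) (Σ-fibrewise↔ (Fin-cong↔ ∘ sizes))

fibreSizes-sum : ∀ {n k} (ρ : Fin n → Fin k) → ∑[ r < k ] fibreSize ρ r ≡ n
fibreSizes-sum {n} {k} ρ = begin
  ∑[ r < k ] fibreSize ρ r                 ≡⟨ ∑-cong (λ r → count≡∑ (λ x → ρ x ≡ᵇ r)) ⟩
  ∑[ r < k ] ∑[ x < n ] ⟦ ρ x ≡ᵇ r ⟧       ≡⟨ ∑-comm (λ r x → ⟦ ρ x ≡ᵇ r ⟧) ⟩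
  ∑[ x < n ] ∑[ r < k ] ⟦ ρ x ≡ᵇ r ⟧       ≡⟨ ∑-cong (λ x → trans (∑-cong (λ r → cong ⟦_⟧ (≡ᵇ-sym (ρ x) r))) (∑-point (ρ x))) ⟩
  ∑[ x < n ] 1                             ≡⟨ ∑-one n ⟩
  n                                        ∎
  where open ≡-Reasoning

module _ {n k} (ρ : Fin n → Fin k) where

  fibreSize-≥1 : ∀ x {r} → ρ x ≡ r → 1 ≤ fibreSize ρ r
  fibreSize-≥1 x {r} refl = count-≥1 (λ x′ → ρ x′ ≡ᵇ r) (≡ᵇ-refl (ρ x))

  fibreSize-witness : ∀ {r} → 1 ≤ fibreSize ρ r → ∃ λ x → ρ x ≡ r
  fibreSize-witness {r} 1≤size with x , ρx≡ᵇr ← count-witness (λ x → ρ x ≡ᵇ r) 1≤size = x , does-true (ρ x ≟ r) ρx≡ᵇr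

  fibreSize-singleton : ∀ {x r} → ρ x ≡ r → (∀ x′ → ρ x′ ≡ r → x′ ≡ x) → fibreSize ρ r ≡ 1
  fibreSize-singleton {x} {r} refl unique =
    count-unique (λ x′ → ρ x′ ≡ᵇ r) (≡ᵇ-refl (ρ x)) (λ x′ e → unique x′ (does-true (ρ x′ ≟ r) e))

-- The star and the graph J as role models. Roles are elements of Fin k, which
-- provides their decidable equality; yRole, …, cRole stand for y, z, A, B, C.

pattern hubRole  = zero
pattern leafRole = suc zero

starSizes : ℕ → Fin 2 → ℕ
starSizes m hubRole  = 1
starSizes m leafRole = m

starRoleAdj : Fin 2 → Fin 2 → Bool
starRoleAdj r r′ = not (r ≡ᵇ r′)

Σstar↔StarV : ∀ m → Σ (Fin 2) (Fin ∘ starSizes m) ↔ StarV m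
Σstar↔StarV m = mk↔ₛ′
  (λ { (hubRole , _) → center ; (leafRole , i) → leaf i })
  (λ { center → hubRole , zero ; (leaf i) → leafRole , i })
  (λ { center → refl ; (leaf _) → refl })
  (λ { (hubRole , zero) → refl ; (leafRole , _) → refl })

Σstar↔StarV-adj : ∀ m p q → starAdj (Inverse.to (Σstar↔StarV m) p) (Inverse.to (Σstar↔StarV m) q) ≡ starRoleAdj (proj₁ p) (proj₁ q)
Σstar↔StarV-adj m (hubRole  , _) (hubRole  , _) = refl
Σstar↔StarV-adj m (hubRole  , _) (leafRole , _) = refl
Σstar↔StarV-adj m (leafRole , _) (hubRole  , _) = refl
Σstar↔StarV-adj m (leafRole , _) (leafRole , _) = refl

pattern yRole = zero
pattern zRole = suc zero
pattern aRole = suc (suc zero)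
pattern bRole = suc (suc (suc zero))
pattern cRole = suc (suc (suc (suc zero)))

jSizes : ℕ → ℕ → ℕ → Fin 5 → ℕ
jSizes a b c yRole = 1
jSizes a b c zRole = 1
jSizes a b c aRole = a
jSizes a b c bRole = b
jSizes a b c cRole = c

jRep : Fin 5 → JV 1 1 1
jRep yRole = y
jRep zRole = z
jRep aRole = inA zero
jRep bRole = inB zero
jRep cRole = inC zero

jRoleAdj : Fin 5 → Fin 5 → Bool
jRoleAdj r r′ = JAdj (jRep r) (jRep r′)

ΣJ↔JV : ∀ a b c → Σ (Fin 5) (Fin ∘ jSizes a b c) ↔ JV a b c
ΣJ↔JV a b c = mk↔ₛ′
  (λ { (yRole , _) → y ; (zRole , _) → z ; (aRole , i) → inA i ; (bRole , i) → inB i ; (cRole , i) → inC i })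
  (λ { y → yRole , zero ; z → zRole , zero ; (inA i) → aRole , i ; (inB i) → bRole , i ; (inC i) → cRole , i })
  (λ { y → refl ; z → refl ; (inA _) → refl ; (inB _) → refl ; (inC _) → refl })
  (λ { (yRole , zero) → refl ; (zRole , zero) → refl ; (aRole , _) → refl ; (bRole , _) → refl ; (cRole , _) → refl })

ΣJ↔JV-adj : ∀ a b c p q → JAdj (Inverse.to (ΣJ↔JV a b c) p) (Inverse.to (ΣJ↔JV a b c) q) ≡ jRoleAdj (proj₁ p) (proj₁ q)
ΣJ↔JV-adj a b c (yRole , _) (yRole , _) = refl
ΣJ↔JV-adj a b c (yRole , _) (zRole , _) = refl
ΣJ↔JV-adj a b c (yRole , _) (aRole , _) = refl
ΣJ↔JV-adj a b c (yRole , _) (bRole , _) = refl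
ΣJ↔JV-adj a b c (yRole , _) (cRole , _) = refl
ΣJ↔JV-adj a b c (zRole , _) (yRole , _) = refl
ΣJ↔JV-adj a b c (zRole , _) (zRole , _) = refl
ΣJ↔JV-adj a b c (zRole , _) (aRole , _) = refl
ΣJ↔JV-adj a b c (zRole , _) (bRole , _) = refl
ΣJ↔JV-adj a b c (zRole , _) (cRole , _) = refl
ΣJ↔JV-adj a b c (aRole , _) (yRole , _) = refl
ΣJ↔JV-adj a b c (aRole , _) (zRole , _) = refl
ΣJ↔JV-adj a b c (aRole , _) (aRole , _) = refl
ΣJ↔JV-adj a b c (aRole , _) (bRole , _) = refl
ΣJ↔JV-adj a b c (aRole , _) (cRole , _) = refl
ΣJ↔JV-adj a b c (bRole , _) (yRole , _) = refl
ΣJ↔JV-adj a b c (bRole , _) (zRole , _) = refl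
ΣJ↔JV-adj a b c (bRole , _) (aRole , _) = refl
ΣJ↔JV-adj a b c (bRole , _) (bRole , _) = refl
ΣJ↔JV-adj a b c (bRole , _) (cRole , _) = refl
ΣJ↔JV-adj a b c (cRole , _) (yRole , _) = refl
ΣJ↔JV-adj a b c (cRole , _) (zRole , _) = refl
ΣJ↔JV-adj a b c (cRole , _) (aRole , _) = refl
ΣJ↔JV-adj a b c (cRole , _) (bRole , _) = refl
ΣJ↔JV-adj a b c (cRole , _) (cRole , _) = refl

both-or-neither : ∀ {b c} → (1 ≤ b → 1 ≤ c) → (1 ≤ c → 1 ≤ b) → ((b ≡ 0) × (c ≡ 0)) ⊎ ((b ≥ 1) × (c ≥ 1))
both-or-neither {zero}  {zero}  _   _   = inj₁ (refl , refl)
both-or-neither {zero}  {suc c} _   c⇒b with () ← c⇒b (s≤s z≤n)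
both-or-neither {suc b} {zero}  b⇒c _   with () ← b⇒c (s≤s z≤n)
both-or-neither {suc b} {suc c} _   _   = inj₂ (s≤s z≤n , s≤s z≤n)

-- K₃-saturated graphs

module Saturated {n} (G : Graph n) (sat : K3Saturated G) where

  nonadjacent : ∀ {x i j} → adj G x i ≡ true → adj G x j ≡ true → adj G i j ≡ false
  nonadjacent = triangleFree⇒nonadjacent G (proj₁ sat)

  common-neighbour : ∀ {u v} → u ≢ v → adj G u v ≡ false → ∃ λ w → adj G u w ≡ true × adj G v w ≡ true
  common-neighbour {u} {v} u≢v uv = addEdge-triangle⇒common G u≢v (proj₁ sat) (proj₂ sat u v u≢v uv)

  module ClosedNeighbourhood {δ} (δ≤deg : ∀ w → δ ≤ deg G w) {v} (deg-v : deg G v ≡ δ) where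

    P : Fin n → Bool
    P w = adj G v w ∨ (w ≡ᵇ v)

    N⊆P : ∀ {k} → adj G v k ≡ true → P k ≡ true
    N⊆P {k} vk = cong (_∨ (k ≡ᵇ v)) vk

    v∈P : P v ≡ true
    v∈P = trans (cong (adj G v v ∨_) (≡ᵇ-refl v)) (∨-zeroʳ (adj G v v))

    |P| : count P ≡ δ + 1
    |P| = trans (count-∨ (adj G v) (_≡ᵇ v) (λ k vk → ≢⇒≡ᵇ-false (adjacent⇒≢ G vk))) (cong₂ _+_ deg-v (count-point v))

    P-neighbour : ∀ {w} → w ≢ v → 1 ≤ degIn G P w
    P-neighbour {w} w≢v with adj G v w in vw
    ... | true = degIn-≥1 G P (sym-adj G vw) v∈P
    ... | false with x , vx , wx ← common-neighbour (w≢v ∘ sym) vw = degIn-≥1 G P wx (N⊆P vx)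

    -- A w neighbours of w lie in P, except that v has only δ of them: s makes up for it.
    A s : Fin n → ℕ
    A w = 1 + (if w ≡ᵇ v then δ else 0)
    s w = ⟦ w ≡ᵇ v ⟧

    A≤ : ∀ w → A w ≤ degIn G P w + s w
    A≤ w with w ≟ v
    ... | yes refl = begin
      1 + δ           ≡⟨ +-comm 1 δ ⟩
      δ + 1           ≡⟨ cong (_+ 1) deg-v ⟨
      deg G v + 1     ≤⟨ +-monoˡ-≤ 1 (deg≤degIn G P N⊆P) ⟩
      degIn G P v + 1 ∎
      where open ≤-Reasoning
    ... | no w≢v = ≤-trans (P-neighbour w≢v) (m≤m+n _ 0)

    ∑A : ∑ A ≡ n + δ
    ∑A = trans (∑-distrib-+ (λ _ → 1) (λ w → if w ≡ᵇ v then δ else 0)) (cong₂ _+_ (∑-one n) (∑-at v δ))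

    closedNeighbourhood-bound : (δ + 1) * n ≤ 2 * edges G + δ * δ + 1
    closedNeighbourhood-bound = begin
      (δ + 1) * n                          ≡⟨ cong ((δ + 1) *_) n≡ ⟨
      (δ + 1) * (δ + 1 + c)                ≡⟨ expand δ c ⟩
      (δ + 1 + c) + δ + c * δ + δ * δ      ≡⟨ cong (λ m → m + δ + c * δ + δ * δ) n≡ ⟩
      n + δ + c * δ + δ * δ                ≡⟨ cong (λ m → m + c * δ + δ * δ) ∑A ⟨
      ∑ A + c * δ + δ * δ                  ≤⟨ +-monoˡ-≤ (δ * δ) (degreeSum-lowerBound G P A s δ≤deg A≤) ⟩
      2 * edges G + ∑ s + δ * δ            ≡⟨ cong (λ m → 2 * edges G + m + δ * δ) (∑-point v) ⟩
      2 * edges G + 1 + δ * δ              ≡⟨ +-comm-last (2 * edges G) 1 (δ * δ) ⟩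
      2 * edges G + δ * δ + 1              ∎
      where
      open ≤-Reasoning
      c : ℕ
      c = count (not ∘ P)
      n≡ : δ + 1 + c ≡ n
      n≡ = trans (cong (_+ c) (sym |P|)) (count-complement P)
      expand : ∀ δ c → (δ + 1) * (δ + 1 + c) ≡ (δ + 1 + c) + δ + c * δ + δ * δ
      expand = solve-∀

  module EdgeNeighbourhood {δ} (δ≤deg : ∀ w → δ ≤ deg G w) {v} (deg-v : deg G v ≡ δ)
                           {u t} (uv : adj G u v ≡ true) (deg-u : deg G u ≡ t) where

    P : Fin n → Bool
    P w = adj G v w ∨ adj G u w

    vu : adj G v u ≡ true
    vu = sym-adj G uv

    Nv⊆P : ∀ {k} → adj G v k ≡ true → P k ≡ true
    Nv⊆P {k} vk = cong (_∨ adj G u k) vk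

    Nu⊆P : ∀ {k} → adj G u k ≡ true → P k ≡ true
    Nu⊆P {k} uk = trans (cong (adj G v k ∨_) uk) (∨-zeroʳ (adj G v k))

    |P| : count P ≡ δ + t
    |P| = trans (count-∨ (adj G v) (adj G u) (λ k vk → nonadjacent vu vk)) (cong₂ _+_ deg-v deg-u)

    P-neighbours : ∀ {w} → w ≢ v → w ≢ u → 1 + ⟦ not (P w) ⟧ ≤ degIn G P w
    P-neighbours {w} w≢v w≢u with adj G v w in vw | adj G u w in uw
    ... | true  | _    = degIn-≥1 G P (sym-adj G vw) (Nu⊆P uv)
    ... | false | true = degIn-≥1 G P (sym-adj G uw) (Nv⊆P vu)
    ... | false | false
      with x , vx , wx ← common-neighbour (w≢v ∘ sym) vw | x′ , ux′ , wx′ ← common-neighbour (w≢u ∘ sym) uw =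
      degIn-≥2 G P wx (Nv⊆P vx) wx′ (Nu⊆P ux′) x′≢x
      where
      x′≢x : x′ ≢ x
      x′≢x refl = not-both uv (nonadjacent (sym-adj G ux′) (sym-adj G vx))

    -- At least A w neighbours of w lie in P, up to the correction s at v and u.
    A s : Fin n → ℕ
    A w = 1 + ⟦ not (P w) ⟧ + (if w ≡ᵇ v then δ else 0) + (if w ≡ᵇ u then t else 0)
    s w = ⟦ w ≡ᵇ v ⟧ + ⟦ w ≡ᵇ u ⟧

    A≤ : ∀ w → A w ≤ degIn G P w + s w
    A≤ w with w ≟ v | w ≟ u
    ... | yes refl | yes refl = ⊥-elim (adjacent⇒≢ G uv refl)
    ... | yes refl | no _ rewrite Nu⊆P uv | +-identityʳ δ = begin
      1 + δ           ≡⟨ +-comm 1 δ ⟩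
      δ + 1           ≡⟨ cong (_+ 1) deg-v ⟨
      deg G v + 1     ≤⟨ +-monoˡ-≤ 1 (deg≤degIn G P Nv⊆P) ⟩
      degIn G P v + 1 ∎
      where open ≤-Reasoning
    ... | no _ | yes refl rewrite Nv⊆P vu = begin
      1 + t           ≡⟨ +-comm 1 t ⟩
      t + 1           ≡⟨ cong (_+ 1) deg-u ⟨
      deg G u + 1     ≤⟨ +-monoˡ-≤ 1 (deg≤degIn G P Nu⊆P) ⟩
      degIn G P u + 1 ∎
      where open ≤-Reasoning
    ... | no w≢v | no w≢u = begin
      1 + ⟦ not (P w) ⟧ + 0 + 0 ≡⟨ trans (+-identityʳ _) (+-identityʳ _) ⟩
      1 + ⟦ not (P w) ⟧         ≤⟨ P-neighbours w≢v w≢u ⟩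
      degIn G P w               ≡⟨ +-identityʳ _ ⟨
      degIn G P w + 0           ∎
      where open ≤-Reasoning

    ∑A : ∑ A ≡ n + count (not ∘ P) + δ + t
    ∑A = begin
      ∑ A
        ≡⟨ ∑-distrib-+ (λ w → 1 + ⟦ not (P w) ⟧ + (if w ≡ᵇ v then δ else 0)) (λ w → if w ≡ᵇ u then t else 0) ⟩
      ∑[ w < n ] (1 + ⟦ not (P w) ⟧ + (if w ≡ᵇ v then δ else 0)) + ∑[ w < n ] (if w ≡ᵇ u then t else 0)
        ≡⟨ cong₂ _+_ (∑-distrib-+ (λ w → 1 + ⟦ not (P w) ⟧) (λ w → if w ≡ᵇ v then δ else 0)) (∑-at u t) ⟩
      ∑[ w < n ] (1 + ⟦ not (P w) ⟧) + ∑[ w < n ] (if w ≡ᵇ v then δ else 0) + t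
        ≡⟨ cong₂ (λ a b → a + b + t) (∑-distrib-+ (λ _ → 1) (λ w → ⟦ not (P w) ⟧)) (∑-at v δ) ⟩
      ∑[ w < n ] 1 + ∑[ w < n ] ⟦ not (P w) ⟧ + δ + t
        ≡⟨ cong₂ (λ a b → a + b + δ + t) (∑-one n) (sym (count≡∑ (not ∘ P))) ⟩
      n + count (not ∘ P) + δ + t
        ∎
      where open ≡-Reasoning

    ∑s : ∑ s ≡ 2
    ∑s = trans (∑-distrib-+ (λ w → ⟦ w ≡ᵇ v ⟧) (λ w → ⟦ w ≡ᵇ u ⟧)) (cong₂ _+_ (∑-point v) (∑-point u))

    edgeNeighbourhood-bound : (δ + 2) * n ≤ 2 * edges G + δ * (δ + t) + 2
    edgeNeighbourhood-bound = begin
      (δ + 2) * n                                   ≡⟨ cong ((δ + 2) *_) n≡ ⟨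
      (δ + 2) * (δ + t + c)                         ≡⟨ expand δ t c ⟩
      (δ + t + c) + c + δ + t + c * δ + δ * (δ + t) ≡⟨ cong (λ m → m + c + δ + t + c * δ + δ * (δ + t)) n≡ ⟩
      n + c + δ + t + c * δ + δ * (δ + t)           ≡⟨ cong (λ m → m + c * δ + δ * (δ + t)) ∑A ⟨
      ∑ A + c * δ + δ * (δ + t)                     ≤⟨ +-monoˡ-≤ (δ * (δ + t)) (degreeSum-lowerBound G P A s δ≤deg A≤) ⟩
      2 * edges G + ∑ s + δ * (δ + t)               ≡⟨ cong (λ m → 2 * edges G + m + δ * (δ + t)) ∑s ⟩
      2 * edges G + 2 + δ * (δ + t)                 ≡⟨ +-comm-last (2 * edges G) 2 (δ * (δ + t)) ⟩
      2 * edges G + δ * (δ + t) + 2                 ∎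
      where
      open ≤-Reasoning
      c : ℕ
      c = count (not ∘ P)
      n≡ : δ + t + c ≡ n
      n≡ = trans (cong (_+ c) (sym |P|)) (count-complement P)
      expand : ∀ δ t c → (δ + 2) * (δ + t + c) ≡ (δ + t + c) + c + δ + t + c * δ + δ * (δ + t)
      expand = solve-∀

  open ClosedNeighbourhood public using (closedNeighbourhood-bound)
  open EdgeNeighbourhood public using (edgeNeighbourhood-bound)

  star-structure : ∀ {v} → deg G v ≡ 1 → IsoTo G (StarV (n ∸ 1)) starAdj
  star-structure {v} deg-v =
    IsoTo-byRoles G ρ starRoleAdj {WAdj = starAdj} (starSizes (n ∸ 1)) adj-byRole sizes (Σstar↔StarV (n ∸ 1)) (Σstar↔StarV-adj (n ∸ 1))
    where
    hub : Fin n
    hub = proj₁ (count-≡1 (adj G v) deg-v)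
    v-hub : adj G v hub ≡ true
    v-hub = proj₁ (proj₂ (count-≡1 (adj G v) deg-v))
    only-hub : ∀ x → adj G v x ≡ true → x ≡ hub
    only-hub = proj₂ (proj₂ (count-≡1 (adj G v) deg-v))

    hub-adj : ∀ x → x ≢ hub → adj G hub x ≡ true
    hub-adj x x≢hub with x ≟ v
    ... | yes refl = sym-adj G v-hub
    ... | no x≢v with adj G v x in vx
    ... | true = ⊥-elim (x≢hub (only-hub x vx))
    ... | false with w , vw , xw ← common-neighbour (x≢v ∘ sym) vx rewrite only-hub w vw = sym-adj G xw

    ρ : Fin n → Fin 2
    ρ x = if x ≡ᵇ hub then hubRole else leafRole

    adj-byRole : ∀ i j → adj G i j ≡ starRoleAdj (ρ i) (ρ j)
    adj-byRole i j with i ≟ hub | j ≟ hub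
    ... | yes refl | yes refl = irrefl G i
    ... | yes refl | no j≢hub = hub-adj j j≢hub
    ... | no i≢hub | yes refl = sym-adj G (hub-adj i i≢hub)
    ... | no i≢hub | no j≢hub = nonadjacent (hub-adj i i≢hub) (hub-adj j j≢hub)

    hubFibre : fibreSize ρ hubRole ≡ 1
    hubFibre = trans (count-cong is-hub) (count-point hub)
      where
      is-hub : ∀ x → (ρ x ≡ᵇ hubRole) ≡ (x ≡ᵇ hub)
      is-hub x with x ≟ hub
      ... | yes _ = refl
      ... | no _  = refl

    sizes : ∀ r → fibreSize ρ r ≡ starSizes (n ∸ 1) r
    sizes hubRole  = hubFibre
    sizes leafRole = cong (_∸ 1) (trans (cong₂ _+_ (sym hubFibre) (sym (+-identityʳ _))) (fibreSizes-sum ρ))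

module DegreeTwo {n} (G : Graph n) (sat : K3Saturated G) (δ≤deg : ∀ w → 2 ≤ deg G w)
  {v y₀ z₀} (z₀≢y₀ : z₀ ≢ y₀) (v-y₀ : adj G v y₀ ≡ true) (v-z₀ : adj G v z₀ ≡ true)
  (N[v] : ∀ k → adj G v k ≡ true → k ≡ y₀ ⊎ k ≡ z₀) where
  open Saturated G sat

  y₀-z₀ : adj G y₀ z₀ ≡ false
  y₀-z₀ = nonadjacent v-y₀ v-z₀

  -- v is adjacent to y₀; any other vertex has a common neighbour with v
  cover : ∀ x → x ≢ y₀ → x ≢ z₀ → adj G y₀ x ≡ true ⊎ adj G z₀ x ≡ true
  cover x x≢y₀ x≢z₀ with x ≟ v
  ... | yes refl = inj₁ (sym-adj G v-y₀)
  ... | no x≢v with adj G v x in vx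
  ... | true = ⊥-elim ([ x≢y₀ , x≢z₀ ]′ (N[v] x vx))
  ... | false with w , vw , xw ← common-neighbour (x≢v ∘ sym) vx with N[v] w vw
  ... | inj₁ refl = inj₁ (sym-adj G xw)
  ... | inj₂ refl = inj₂ (sym-adj G xw)

  roleOf : Bool → Bool → Fin 5
  roleOf true  true  = aRole
  roleOf true  false = bRole
  roleOf false _     = cRole

  ρ : Fin n → Fin 5
  ρ x = if x ≡ᵇ y₀ then yRole else if x ≡ᵇ z₀ then zRole else roleOf (adj G y₀ x) (adj G z₀ x)

  data Place (x : Fin n) : Fin 5 → Set where
    at-y₀ : x ≡ y₀ → Place x yRole
    at-z₀ : x ≡ z₀ → Place x zRole
    in-A  : adj G y₀ x ≡ true  → adj G z₀ x ≡ true  → Place x aRole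
    in-B  : adj G y₀ x ≡ true  → adj G z₀ x ≡ false → Place x bRole
    in-C  : adj G y₀ x ≡ false → adj G z₀ x ≡ true  → Place x cRole

  place : ∀ x → Place x (ρ x)
  place x with x ≟ y₀
  ... | yes x≡y₀ = at-y₀ x≡y₀
  ... | no x≢y₀ with x ≟ z₀
  ... | yes x≡z₀ = at-z₀ x≡z₀
  ... | no x≢z₀ with adj G y₀ x in y₀x | adj G z₀ x in z₀x
  ... | true  | true  = in-A y₀x z₀x
  ... | true  | false = in-B y₀x z₀x
  ... | false | true  = in-C y₀x z₀x
  ... | false | false with cover x x≢y₀ x≢z₀
  ...   | inj₁ y₀x′ = ⊥-elim (not-both y₀x′ y₀x)
  ...   | inj₂ z₀x′ = ⊥-elim (not-both z₀x′ z₀x)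

  ρ-away : ∀ {x} → x ≢ y₀ → x ≢ z₀ → ρ x ≡ roleOf (adj G y₀ x) (adj G z₀ x)
  ρ-away x≢y₀ x≢z₀ rewrite ≢⇒≡ᵇ-false x≢y₀ | ≢⇒≡ᵇ-false x≢z₀ = refl

  ρ-y₀ : ρ y₀ ≡ yRole
  ρ-y₀ rewrite ≡ᵇ-refl y₀ = refl

  ρ-z₀ : ρ z₀ ≡ zRole
  ρ-z₀ rewrite ≢⇒≡ᵇ-false z₀≢y₀ | ≡ᵇ-refl z₀ = refl

  placed : ∀ x {r} → ρ x ≡ r → Place x r
  placed x refl = place x

  B-C-adjacent : ∀ {x x′} → adj G y₀ x ≡ true → adj G z₀ x ≡ false →
                 adj G y₀ x′ ≡ false → adj G z₀ x′ ≡ true → adj G x x′ ≡ true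
  B-C-adjacent {x} {x′} y₀x z₀x y₀x′ z₀x′ with adj G x x′ in xx′
  ... | true = refl
  ... | false with w , xw , x′w ← common-neighbour (λ { refl → not-both y₀x y₀x′ }) xx′ with w ≟ y₀ | w ≟ z₀
  ... | yes refl | _        = ⊥-elim (not-both (sym-adj G x′w) y₀x′)
  ... | no _     | yes refl = ⊥-elim (not-both (sym-adj G xw) z₀x)
  ... | no w≢y₀  | no w≢z₀ with cover w w≢y₀ w≢z₀
  ...   | inj₁ y₀w = ⊥-elim (not-both xw (nonadjacent y₀x y₀w))
  ...   | inj₂ z₀w = ⊥-elim (not-both x′w (nonadjacent z₀x′ z₀w))

  adj-byPlace : ∀ {i j r r′} → Place i r → Place j r′ → adj G i j ≡ jRoleAdj r r′
  adj-byPlace (at-y₀ refl) (at-y₀ refl) = irrefl G y₀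
  adj-byPlace (at-y₀ refl) (at-z₀ refl) = y₀-z₀
  adj-byPlace (at-y₀ refl) (in-A y₀j _) = y₀j
  adj-byPlace (at-y₀ refl) (in-B y₀j _) = y₀j
  adj-byPlace (at-y₀ refl) (in-C y₀j _) = y₀j
  adj-byPlace (at-z₀ refl) (at-y₀ refl) = sym-adj G y₀-z₀
  adj-byPlace (at-z₀ refl) (at-z₀ refl) = irrefl G z₀
  adj-byPlace (at-z₀ refl) (in-A _ z₀j) = z₀j
  adj-byPlace (at-z₀ refl) (in-B _ z₀j) = z₀j
  adj-byPlace (at-z₀ refl) (in-C _ z₀j) = z₀j
  adj-byPlace (in-A y₀i _) (at-y₀ refl) = sym-adj G y₀i
  adj-byPlace (in-A _ z₀i) (at-z₀ refl) = sym-adj G z₀i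
  adj-byPlace (in-A y₀i _) (in-A y₀j _) = nonadjacent y₀i y₀j
  adj-byPlace (in-A y₀i _) (in-B y₀j _) = nonadjacent y₀i y₀j
  adj-byPlace (in-A _ z₀i) (in-C _ z₀j) = nonadjacent z₀i z₀j
  adj-byPlace (in-B y₀i _) (at-y₀ refl) = sym-adj G y₀i
  adj-byPlace (in-B _ z₀i) (at-z₀ refl) = sym-adj G z₀i
  adj-byPlace (in-B y₀i _) (in-A y₀j _) = nonadjacent y₀i y₀j
  adj-byPlace (in-B y₀i _) (in-B y₀j _) = nonadjacent y₀i y₀j
  adj-byPlace (in-B y₀i z₀i) (in-C y₀j z₀j) = B-C-adjacent y₀i z₀i y₀j z₀j
  adj-byPlace (in-C y₀i _) (at-y₀ refl) = sym-adj G y₀i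
  adj-byPlace (in-C _ z₀i) (at-z₀ refl) = sym-adj G z₀i
  adj-byPlace (in-C _ z₀i) (in-A _ z₀j) = nonadjacent z₀i z₀j
  adj-byPlace (in-C y₀i z₀i) (in-B y₀j z₀j) = sym-adj G (B-C-adjacent y₀j z₀j y₀i z₀i)
  adj-byPlace (in-C _ z₀i) (in-C _ z₀j) = nonadjacent z₀i z₀j

  -- Since δ ≥ 2, x has a neighbour j ≠ p; it is not adjacent to p, so it is adjacent to q.
  neighbour-across : ∀ {p q x} → (∀ j → j ≢ p → j ≢ q → adj G p j ≡ true ⊎ adj G q j ≡ true) →
                     adj G p x ≡ true → adj G q x ≡ false →
                     ∃ λ j → j ≢ p × j ≢ q × adj G p j ≡ false × adj G q j ≡ true
  neighbour-across {p} {q} {x} cover′ px qx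
    with j , x∖p-j ← count-witness (adj G x ∖ p) (≤-pred (subst (2 ≤_) (count-remove (adj G x) (sym-adj G px)) (δ≤deg x)))
    with xj , j≢p ← ∖-elim {p = adj G x} x∖p-j = j , j≢p , j≢q , pj , qj
    where
    j≢q : j ≢ q
    j≢q refl = not-both (sym-adj G xj) qx
    pj : adj G p j ≡ false
    pj = nonadjacent (sym-adj G px) xj
    qj : adj G q j ≡ true
    qj with cover′ j j≢p j≢q
    ... | inj₁ pj′ = ⊥-elim (not-both pj′ pj)
    ... | inj₂ qj′ = qj′

  a b c : ℕ
  a = fibreSize ρ aRole
  b = fibreSize ρ bRole
  c = fibreSize ρ cRole

  sizes : ∀ r → fibreSize ρ r ≡ jSizes a b c r
  sizes yRole = fibreSize-singleton ρ ρ-y₀ (λ x ρx → at-y₀⁻¹ (placed x ρx))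
    where
    at-y₀⁻¹ : ∀ {x} → Place x yRole → x ≡ y₀
    at-y₀⁻¹ (at-y₀ x≡y₀) = x≡y₀
  sizes zRole = fibreSize-singleton ρ ρ-z₀ (λ x ρx → at-z₀⁻¹ (placed x ρx))
    where
    at-z₀⁻¹ : ∀ {x} → Place x zRole → x ≡ z₀
    at-z₀⁻¹ (at-z₀ x≡z₀) = x≡z₀
  sizes aRole = refl
  sizes bRole = refl
  sizes cRole = refl

  a≥1 : a ≥ 1
  a≥1 = fibreSize-≥1 ρ v (trans (ρ-away (adjacent⇒≢ G v-y₀ ∘ sym) (adjacent⇒≢ G v-z₀ ∘ sym))
                                (cong₂ roleOf (sym-adj G v-y₀) (sym-adj G v-z₀)))

  b≥1⇒c≥1 : b ≥ 1 → c ≥ 1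
  b≥1⇒c≥1 b≥1 with x , ρx ← fibreSize-witness ρ {r = bRole} b≥1 with in-B y₀x z₀x ← placed x ρx
    with j , j≢y₀ , j≢z₀ , y₀j , z₀j ← neighbour-across cover y₀x z₀x =
    fibreSize-≥1 ρ j (trans (ρ-away j≢y₀ j≢z₀) (cong₂ roleOf y₀j z₀j))

  c≥1⇒b≥1 : c ≥ 1 → b ≥ 1
  c≥1⇒b≥1 c≥1 with x , ρx ← fibreSize-witness ρ {r = cRole} c≥1 with in-C y₀x z₀x ← placed x ρx
    with j , j≢z₀ , j≢y₀ , z₀j , y₀j ← neighbour-across (λ j j≢z₀ j≢y₀ → swap (cover j j≢y₀ j≢z₀)) z₀x y₀x =
    fibreSize-≥1 ρ j (trans (ρ-away j≢y₀ j≢z₀) (cong₂ roleOf y₀j z₀j))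

  a+b+c≡n∸2 : a + b + c ≡ n ∸ 2
  a+b+c≡n∸2 = begin
    a + b + c                         ≡⟨ +-assoc a b c ⟩
    a + (b + c)                       ≡⟨ cong (λ m → a + (b + m)) (+-identityʳ c) ⟨
    2 + (a + (b + (c + 0))) ∸ 2       ≡⟨ cong (_∸ 2) all-fibres ⟩
    n ∸ 2                             ∎
    where
    open ≡-Reasoning
    all-fibres : 1 + (1 + (a + (b + (c + 0)))) ≡ n
    all-fibres = trans (cong₂ (λ s t → s + (t + (a + (b + (c + 0))))) (sym (sizes yRole)) (sym (sizes zRole)))
                       (fibreSizes-sum ρ)

  J-structure : Σ ℕ λ a → Σ ℕ λ b → Σ ℕ λ c →
                (a ≥ 1) × (((b ≡ 0) × (c ≡ 0)) ⊎ ((b ≥ 1) × (c ≥ 1))) × (a + b + c ≡ n ∸ 2) × IsoTo G (JV a b c) JAdj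
  J-structure = a , b , c , a≥1 , both-or-neither b≥1⇒c≥1 c≥1⇒b≥1 , a+b+c≡n∸2 ,
    IsoTo-byRoles G ρ jRoleAdj {WAdj = JAdj} (jSizes a b c) (λ i j → adj-byPlace (place i) (place j)) sizes (ΣJ↔JV a b c) (ΣJ↔JV-adj a b c)

lemma2p4 : ∀ {n} (G : Graph n) (δ : ℕ) → K3Saturated G → MinDegree G δ →
    ((δ ≡ 1) → IsoTo G (StarV (n ∸ 1)) starAdj)
    × ((δ ≡ 2) → Σ ℕ λ a → Σ ℕ λ b → Σ ℕ λ c →
         (a ≥ 1) × (((b ≡ 0) × (c ≡ 0)) ⊎ ((b ≥ 1) × (c ≥ 1)))
         × (a + b + c ≡ n ∸ 2) × IsoTo G (JV a b c) JAdj)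
    × ((δ ≥ 3) → ∀ t →
         (∃ λ u → ∃ λ v → (deg G v ≡ δ) × (adj G u v ≡ true) × (deg G u ≡ t)) →
         (∀ u v → deg G v ≡ δ → adj G u v ≡ true → t ≤ deg G u) →
         ((δ + 1) * n ≤ 2 * edges G + δ * δ + 1)
         × ((δ + 2) * n ≤ 2 * edges G + δ * (δ + t) + 2))
lemma2p4 {n} G δ sat ((v , deg-v) , δ≤deg) = part-a , part-b , part-c
  where
  open Saturated G sat

  part-a : δ ≡ 1 → IsoTo G (StarV (n ∸ 1)) starAdj
  part-a refl = star-structure deg-v

  part-b : δ ≡ 2 → Σ ℕ λ a → Σ ℕ λ b → Σ ℕ λ c →
           (a ≥ 1) × (((b ≡ 0) × (c ≡ 0)) ⊎ ((b ≥ 1) × (c ≥ 1))) × (a + b + c ≡ n ∸ 2) × IsoTo G (JV a b c) JAdj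
  part-b refl with y₀ , z₀ , z₀≢y₀ , v-y₀ , v-z₀ , N[v] ← count-≡2 (adj G v) deg-v =
    DegreeTwo.J-structure G sat δ≤deg z₀≢y₀ v-y₀ v-z₀ N[v]

  part-c : δ ≥ 3 → ∀ t → (∃ λ u → ∃ λ v → (deg G v ≡ δ) × (adj G u v ≡ true) × (deg G u ≡ t)) →
           (∀ u v → deg G v ≡ δ → adj G u v ≡ true → t ≤ deg G u) →
           ((δ + 1) * n ≤ 2 * edges G + δ * δ + 1) × ((δ + 2) * n ≤ 2 * edges G + δ * (δ + t) + 2)
  part-c _ t (u , v′ , deg-v′ , u-v′ , deg-u) _ =
    closedNeighbourhood-bound δ≤deg deg-v , edgeNeighbourhood-bound δ≤deg deg-v′ u-v′ deg-u
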